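{- Let $G$ be a connected graph, let $T\in B_2^{a,b}(G)$, and let $T_1,T_2$ be the two subtrees obtained by removing an edge of $T$, with $|V(T_1)|=a$ and $|V(T_2)|=b$. For each $i\in\{1,2\}$ let $e_i$ be an edge of $T_i$ whose removal splits $T_i$ into subtrees $K_i$ and $H_i$. Assume $|V(H_1)|=|V(H_2)|$, that some vertex of $H_1$ is adjacent in $G$ to some vertex of $K_2$, and that some vertex of $H_2$ is adjacent in $G$ to some vertex of $K_1$. Then one or two BUD steps suffice to transform $T$ into a tree $\tilde T\in B_2^{a,b}(G)$ whose corresponding subtrees $\tilde T_1,\tilde T_2$ satisfy $V(\tilde T_1)=V(K_1)\cup V(H_2)$ and $V(\tilde T_2)=V(K_2)\cup V(H_1)$.
   Context: For $a+b=|V(G)|$, $B_2^{a,b}(G)$ is the set of spanning trees $T$ of $G$ containing an edge whose removal splits $T$ into two trees with $a$ and $b$ vertices. A BUD step on $B_2^{a,b}(G)$ from $T$ adds an edge of $E(G)\setminus E(T)$, creating a unique cycle, and removes an edge of that cycle so that the resulting tree lies in $B_2^{a,b}(G)$. -}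

module Defs where

open import Level using (0ℓ)
open import Data.Nat using (ℕ; _≤_)
open import Data.Fin using (Fin)
open import Data.Fin.Subset using (Subset; _∈_; ∣_∣; _∪_)
open import Data.List using (List; []; _∷_; _++_; [_]; length)
open import Data.List.Relation.Unary.Linked using (Linked)
open import Data.List.Relation.Unary.Unique.Propositional using (Unique)
open import Data.Product using (Σ; _×_; _,_; ∃; ∃-syntax)
open import Data.Sum using (_⊎_)
open import Relation.Nullary using (¬_)
open import Relation.Binary.PropositionalEquality using (_≡_)
open import Relation.Binary.Construct.Closure.ReflexiveTransitive using (Star)

EdgeRel : ℕ → Set₁
EdgeRel n = Fin n → Fin n → Set

record Graph (n : ℕ) : Set₁ where
  field
    Adj    : EdgeRel n
    sym    : ∀ {u v} → Adj u v → Adj v u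
    irrefl : ∀ {u} → ¬ Adj u u
open Graph public

Connected : ∀ {n} → Graph n → Set
Connected G = ∀ u v → Star (Adj G) u v

SameEdge : ∀ {n} → Fin n → Fin n → Fin n → Fin n → Set
SameEdge u v x y = (u ≡ x × v ≡ y) ⊎ (u ≡ y × v ≡ x)

insE : ∀ {n} → Fin n → Fin n → EdgeRel n → EdgeRel n
insE x y F u v = F u v ⊎ SameEdge u v x y

delE : ∀ {n} → Fin n → Fin n → EdgeRel n → EdgeRel n
delE x y F u v = F u v × ¬ SameEdge u v x y

-- A cycle u w1 ... wk u (k ≥ 2, distinct vertices) in E, and the
-- (consecutive) edge p q lying on it.
EdgeOnCycle : ∀ {n} → EdgeRel n → Fin n → Fin n → Set
EdgeOnCycle E p q =
  Σ _ λ u → Σ (List _) λ ws →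
    (2 ≤ length ws) × Unique (u ∷ ws) × Linked E (u ∷ ws ++ [ u ]) ×
    (Σ (List _) λ xs → Σ (List _) λ ys → u ∷ ws ++ [ u ] ≡ xs ++ p ∷ q ∷ ys)

Acyclic : ∀ {n} → EdgeRel n → Set
Acyclic E = ∀ p q → ¬ EdgeOnCycle E p q

IsSpanningTree : ∀ {n} → Graph n → EdgeRel n → Set
IsSpanningTree G F =
  (∀ {u v} → F u v → Adj G u v) × (∀ {u v} → F u v → F v u) ×
  (∀ u v → Star F u v) × Acyclic F

Component : ∀ {n} → EdgeRel n → Fin n → Subset n → Set
Component E x C = ∀ v → (v ∈ C → Star E x v) × (Star E x v → v ∈ C)

SplitAt : ∀ {n} → EdgeRel n → Fin n → Fin n → Subset n → Subset n → Set
SplitAt F x y C D = F x y × Component (delE x y F) x C × Component (delE x y F) y D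

B2 : ∀ {n} → Graph n → ℕ → ℕ → EdgeRel n → Set
B2 G a b F = IsSpanningTree G F ×
  (Σ _ λ x → Σ _ λ y → Σ _ λ C → Σ _ λ D →
     SplitAt F x y C D × ∣ C ∣ ≡ a × ∣ D ∣ ≡ b)

BUD : ∀ {n} → Graph n → ℕ → ℕ → EdgeRel n → EdgeRel n → Set
BUD G a b F F' =
  (Σ _ λ u → Σ _ λ v → Adj G u v × ¬ F u v ×
    (Σ _ λ p → Σ _ λ q → EdgeOnCycle (insE u v F) p q ×
      (∀ s t → (F' s t → delE p q (insE u v F) s t) ×
               (delE p q (insE u v F) s t → F' s t)))) ×
  B2 G a b F'

-- Let Forest₂ be T without xy (components T₁, T₂) and Forest₄ be Forest₂ without p₁q₁ and
-- p₂q₂ (components K₁, H₁, K₂, H₂).  Adding h₁k₂ to T closes a cycle running from T₁ to T₂,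
-- so it contains xy, the only edge of T between them; exchanging xy for h₁k₂ gives
-- T′ = Forest₂ + h₁k₂, still split into T₁ and T₂ (when h₁k₂ already is xy, T′ is T).
-- Adding h₂k₁ to T′ closes a cycle entering K₁, and the only edge of T′ entering K₁ is
-- p₁q₁; exchanging it gives T̃ = Forest₄ + p₂q₂ + h₁k₂ + h₂k₁.  Removing p₂q₂ from T̃ leaves
-- K₁ ∪ H₂ joined by h₂k₁ and K₂ ∪ H₁ joined by h₁k₂, of sizes ∣T₁∣ and ∣T₂∣ since ∣H₁∣ = ∣H₂∣.
module Submission where

open import Defs
open import Data.Empty using (⊥; ⊥-elim)
open import Data.Fin using (Fin; _≟_)
open import Data.Fin.Subset using (Subset; _∈_; _∉_; _⊆_; ∣_∣; _∪_; inside; outside)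
open import Data.Fin.Subset.Properties using (x∈p∪q⁺; x∈p∪q⁻; ⊆-antisym)
  renaming (_∈?_ to _∈ˢ?_)
open import Data.List using (List; []; _∷_; _++_; [_]; length; initLast; _∷ʳ′_)
open import Data.List.Membership.Propositional.Properties using (∈-∃++)
import Data.List.Membership.DecPropositional as DecMembership
open import Data.List.Properties using (++-assoc; ∷-injectiveʳ; ∷ʳ-injective)
open import Data.List.Relation.Binary.Permutation.Propositional using (_↭_; ↭-trans; ↭⇒↭ₛ)
open import Data.List.Relation.Binary.Permutation.Propositional.Properties using (++-comm)
open import Data.List.Relation.Binary.Permutation.Setoid.Properties using (Unique-resp-↭)
open import Data.List.Relation.Unary.All as All using (All; []; _∷_)
open import Data.List.Relation.Unary.All.Properties using (¬Any⇒All¬; ++⁻ʳ)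
open import Data.List.Relation.Unary.AllPairs using ([]; _∷_)
open import Data.List.Relation.Unary.Linked as Linked using (Linked; []; [-]; _∷_)
open import Data.List.Relation.Unary.Unique.Propositional using (Unique)
open import Data.Nat using (ℕ; suc; _+_; _≤_; z≤n; s≤s)
open import Data.Nat.Properties using (+-suc)
open import Data.Product using (Σ; _×_; _,_; proj₁; proj₂)
open import Data.Sum using (_⊎_; inj₁; inj₂; [_,_]′)
open import Data.Vec using ([]; _∷_; here; there)
open import Function using (id; _∘_; case_of_)
open import Relation.Binary.Core using (_⇒_; _⇔_)
open import Relation.Binary.Definitions using (Symmetric; _Respects_)
open import Relation.Binary.Construct.Closure.ReflexiveTransitive as Star
  using (Star; ε; _◅_; _◅◅_; _⋆)
open import Relation.Binary.PropositionalEquality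
  using (_≡_; _≢_; refl; trans; cong; subst; setoid; module ≡-Reasoning) renaming (sym to ≡-sym)
open import Relation.Nullary using (¬_; Dec; yes; no)
open import Relation.Nullary.Decidable using (_×-dec_; _⊎-dec_)
open import Relation.Unary using (Decidable)

private
  variable
    n : ℕ
    E E′ F : EdgeRel n
    a b c d h k s t u v w x y z : Fin n
    A C D S : Subset n
    zs : List (Fin n)

-- Unordered edges

SameEdge-swap : SameEdge u v x y → SameEdge v u x y
SameEdge-swap (inj₁ (u≡x , v≡y)) = inj₂ (v≡y , u≡x)
SameEdge-swap (inj₂ (u≡y , v≡x)) = inj₁ (v≡x , u≡y)

SameEdge-flip : SameEdge u v x y → SameEdge u v y x
SameEdge-flip (inj₁ eqs) = inj₂ eqs
SameEdge-flip (inj₂ eqs) = inj₁ eqs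

SameEdge-sym : SameEdge u v x y → SameEdge x y u v
SameEdge-sym (inj₁ (refl , refl)) = inj₁ (refl , refl)
SameEdge-sym (inj₂ (refl , refl)) = inj₂ (refl , refl)

SameEdge-trans : SameEdge u v c d → SameEdge c d x y → SameEdge u v x y
SameEdge-trans (inj₁ (refl , refl)) cd≈xy = cd≈xy
SameEdge-trans (inj₂ (refl , refl)) cd≈xy = SameEdge-swap cd≈xy

SameEdge? : (u v x y : Fin n) → Dec (SameEdge u v x y)
SameEdge? u v x y = (u ≟ x ×-dec v ≟ y) ⊎-dec (u ≟ y ×-dec v ≟ x)

SameEdge-ends : (P : Fin n → Set) → P x → P y → SameEdge u v x y → P u × P v
SameEdge-ends P px py (inj₁ (refl , refl)) = px , py
SameEdge-ends P px py (inj₂ (refl , refl)) = py , px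

SameEdge-leaves : (P : Fin n → Set) → P x → P y → ¬ P u ⊎ ¬ P v → ¬ SameEdge u v x y
SameEdge-leaves P px py (inj₁ ¬pu) uv≈xy = ¬pu (proj₁ (SameEdge-ends P px py uv≈xy))
SameEdge-leaves P px py (inj₂ ¬pv) uv≈xy = ¬pv (proj₂ (SameEdge-ends P px py uv≈xy))

SameEdge-resp : Symmetric E → E x y → SameEdge u v x y → E u v
SameEdge-resp E-sym e (inj₁ (refl , refl)) = e
SameEdge-resp E-sym e (inj₂ (refl , refl)) = E-sym e

insE-sym : Symmetric F → Symmetric (insE x y F)
insE-sym F-sym (inj₁ e) = inj₁ (F-sym e)
insE-sym F-sym (inj₂ st≈xy) = inj₂ (SameEdge-swap st≈xy)

delE-sym : Symmetric F → Symmetric (delE x y F)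
delE-sym F-sym (e , st≉xy) = F-sym e , st≉xy ∘ SameEdge-swap

reinsert : Symmetric F → F x y → SameEdge h k x y → F ⇔ insE h k (delE x y F)
reinsert {F = F} {x = x} {y = y} {h = h} {k = k} F-sym Fxy hk≈xy = to , from
  where
  to : F ⇒ insE h k (delE x y F)
  to {s} {t} Fst with SameEdge? s t x y
  ... | yes st≈xy = inj₂ (SameEdge-trans st≈xy (SameEdge-sym hk≈xy))
  ... | no st≉xy = inj₁ (Fst , st≉xy)
  from : insE h k (delE x y F) ⇒ F
  from (inj₁ (Fst , _)) = Fst
  from (inj₂ st≈hk) = SameEdge-resp F-sym Fxy (SameEdge-trans st≈hk hk≈xy)

-- Reachability and components

Star-preserves : {P : Fin n → Set} → P Respects E → Star E u v → P u → P v
Star-preserves resp ε pu = pu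
Star-preserves resp (e ◅ es) pu = Star-preserves resp es (resp e pu)

Star-restrict : {P : Fin n → Set} → P Respects E → (∀ {s t} → P s → E s t → E′ s t) →
                Star E u v → P u → Star E′ u v
Star-restrict resp E⇒E′ ε pu = ε
Star-restrict resp E⇒E′ (e ◅ es) pu = E⇒E′ pu e ◅ Star-restrict resp E⇒E′ es (resp e pu)

Component-root : Component E z C → z ∈ C
Component-root comp = proj₂ (comp _) ε

Component-reach : Component E z C → v ∈ C → Star E z v
Component-reach comp = proj₁ (comp _)

Component-closed : Component E z C → (_∈ C) Respects E
Component-closed comp e s∈C = proj₂ (comp _) (Component-reach comp s∈C ◅◅ e ◅ ε)

Component-reroot : Symmetric E → Component E z C → w ∈ C → Component E w C
Component-reroot E-sym comp w∈C v =
  (λ v∈C → Star.reverse E-sym (Component-reach comp w∈C) ◅◅ Component-reach comp v∈C) ,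
  (λ path → Star-preserves (Component-closed comp) path w∈C)

Component-mono : E ⇒ E′ → Component E z C → Component E′ w A → z ∈ A → C ⊆ A
Component-mono E⇒E′ C-comp A-comp z∈A v∈C =
  Star-preserves (Component-closed A-comp) (Star.map E⇒E′ (Component-reach C-comp v∈C)) z∈A

Component-resp : Component E z C →
                 (∀ {s t} → s ∈ C → E s t → E′ s t) → (∀ {s t} → s ∈ C → E′ s t → E s t) →
                 Component E′ z C
Component-resp comp E⇒E′ E′⇒E v =
  (λ v∈C → Star-restrict (Component-closed comp) E⇒E′ (Component-reach comp v∈C) (Component-root comp)) ,
  (λ path → Star-preserves (λ e s∈C → Component-closed comp (E′⇒E s∈C e) s∈C) path (Component-root comp))

Component-delE-insE : Component E z C → ¬ (h ∈ C × k ∈ C) → Component (delE h k (insE h k E)) z C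
Component-delE-insE {E = E} {C = C} {h = h} {k = k} comp hk⊄C = Component-resp comp keep (λ _ → drop)
  where
  keep : s ∈ C → E s t → delE h k (insE h k E) s t
  keep s∈C Est = inj₁ Est , λ st≈hk →
    hk⊄C (SameEdge-ends (_∈ C) s∈C (Component-closed comp Est s∈C) (SameEdge-sym st≈hk))
  drop : delE h k (insE h k E) s t → E s t
  drop (inj₁ Est , _) = Est
  drop (inj₂ st≈hk , st≉hk) = ⊥-elim (st≉hk st≈hk)

Component-join : Symmetric E → Component E x C → Component E y D → E ⇒ E′ → E′ u v → u ∈ C → v ∈ D →
                 (∀ {s t} → s ∈ C ∪ D → E′ s t → E s t ⊎ SameEdge s t u v) →
                 Component E′ x (C ∪ D)
Component-join {E = E} {x = x} {C = C} {D = D} {E′ = E′} {u = u} {v = v}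
               E-sym C-comp D-comp E⇒E′ E′uv u∈C v∈D E′-local w =
  reach , (λ path → Star-preserves closed path x∈C∪D)
  where
  x∈C∪D : x ∈ C ∪ D
  x∈C∪D = x∈p∪q⁺ (inj₁ (Component-root C-comp))
  reach : w ∈ C ∪ D → Star E′ x w
  reach w∈C∪D with x∈p∪q⁻ C D w∈C∪D
  ... | inj₁ w∈C = Star.map E⇒E′ (Component-reach C-comp w∈C)
  ... | inj₂ w∈D =
    Star.map E⇒E′ (Component-reach C-comp u∈C) ◅◅ E′uv ◅
    Star.map E⇒E′ (Star.reverse E-sym (Component-reach D-comp v∈D) ◅◅ Component-reach D-comp w∈D)
  closed : (_∈ C ∪ D) Respects E′
  closed e s∈C∪D with E′-local s∈C∪D e
  ... | inj₂ st≈uv = proj₂ (SameEdge-ends (_∈ C ∪ D) (x∈p∪q⁺ (inj₁ u∈C)) (x∈p∪q⁺ (inj₂ v∈D)) st≈uv)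
  ... | inj₁ Est with x∈p∪q⁻ C D s∈C∪D
  ...   | inj₁ s∈C = x∈p∪q⁺ (inj₁ (Component-closed C-comp Est s∈C))
  ...   | inj₂ s∈D = x∈p∪q⁺ (inj₂ (Component-closed D-comp Est s∈D))

CrossesOnlyAt : EdgeRel n → Subset n → Fin n → Fin n → Set
CrossesOnlyAt F S c d = ∀ {s t} → F s t → s ∉ S → t ∈ S → SameEdge s t c d

Component-crossing : Symmetric F → Component (delE c d F) z C → CrossesOnlyAt F C c d
Component-crossing {c = c} {d = d} F-sym comp {s} {t} Fst s∉C t∈C with SameEdge? s t c d
... | yes st≈cd = st≈cd
... | no st≉cd = ⊥-elim (s∉C (Component-closed comp (F-sym Fst , st≉cd ∘ SameEdge-swap) t∈C))

SplitAt-cover : SplitAt F x y C D → Star F x v → v ∈ C ⊎ v ∈ D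
SplitAt-cover {F = F} {x = x} {y = y} {C = C} {D = D} (_ , C-comp , D-comp) path =
  Star-preserves step path (inj₁ (Component-root C-comp))
  where
  step : (λ w → w ∈ C ⊎ w ∈ D) Respects F
  step {s} {t} Fst s∈C⊎D with SameEdge? s t x y | s∈C⊎D
  ... | yes (inj₁ (refl , refl)) | _ = inj₂ (Component-root D-comp)
  ... | yes (inj₂ (refl , refl)) | _ = inj₁ (Component-root C-comp)
  ... | no st≉xy | inj₁ s∈C = inj₁ (Component-closed C-comp (Fst , st≉xy) s∈C)
  ... | no st≉xy | inj₂ s∈D = inj₂ (Component-closed D-comp (Fst , st≉xy) s∈D)

Component-split : Symmetric E → Component E z A → c ∈ A → SplitAt E c d C D → A ≡ C ∪ D
Component-split {A = A} {c = c} {d = d} {C = C} {D = D} E-sym A-comp c∈A split@(Ecd , C-comp , D-comp) =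
  ⊆-antisym
  (λ v∈A → x∈p∪q⁺ (SplitAt-cover split (Component-reach (Component-reroot E-sym A-comp c∈A) v∈A)))
  (λ v∈C∪D → [ Component-mono proj₁ C-comp A-comp c∈A , Component-mono proj₁ D-comp A-comp d∈A ]′
               (x∈p∪q⁻ C D v∈C∪D))
  where
  d∈A : d ∈ A
  d∈A = Component-closed A-comp Ecd c∈A

∣p∪q∣≡∣p∣+∣q∣ : ∀ {m} (p q : Subset m) → (∀ {v} → v ∈ p → v ∈ q → ⊥) → ∣ p ∪ q ∣ ≡ ∣ p ∣ + ∣ q ∣
∣p∪q∣≡∣p∣+∣q∣ [] [] _ = refl
∣p∪q∣≡∣p∣+∣q∣ (inside ∷ p) (inside ∷ q) disjoint = ⊥-elim (disjoint here here)
∣p∪q∣≡∣p∣+∣q∣ (inside ∷ p) (outside ∷ q) disjoint =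
  cong suc (∣p∪q∣≡∣p∣+∣q∣ p q (λ v∈p v∈q → disjoint (there v∈p) (there v∈q)))
∣p∪q∣≡∣p∣+∣q∣ (outside ∷ p) (inside ∷ q) disjoint =
  trans (cong suc (∣p∪q∣≡∣p∣+∣q∣ p q (λ v∈p v∈q → disjoint (there v∈p) (there v∈q)))) (≡-sym (+-suc _ _))
∣p∪q∣≡∣p∣+∣q∣ (outside ∷ p) (outside ∷ q) disjoint =
  ∣p∪q∣≡∣p∣+∣q∣ p q (λ v∈p v∈q → disjoint (there v∈p) (there v∈q))

-- Paths and cycles

Consecutive : Fin n → Fin n → List (Fin n) → Set
Consecutive c d l = Σ (List _) λ xs → Σ (List _) λ ys → l ≡ xs ++ c ∷ d ∷ ys

Consecutive-∷ : Consecutive c d zs → Consecutive c d (w ∷ zs)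
Consecutive-∷ {w = w} (xs , ys , eq) = w ∷ xs , ys , cong (w ∷_) eq

Consecutive-++ : ∀ ws → Consecutive c d zs → Consecutive c d (zs ++ ws)
Consecutive-++ {c = c} {d = d} ws (xs , ys , refl) = xs , ys ++ ws , ++-assoc xs (c ∷ d ∷ ys) ws

Linked-at : ∀ xs {ys} → Linked E (xs ++ c ∷ d ∷ ys) → E c d
Linked-at [] (e ∷ _) = e
Linked-at (_ ∷ xs) linked = Linked-at xs (Linked.tail linked)

Linked-prefix : ∀ xs {ys} → Linked E (xs ++ ys) → Linked E xs
Linked-prefix [] _ = []
Linked-prefix (_ ∷ []) _ = [-]
Linked-prefix (_ ∷ x ∷ xs) (e ∷ linked) = e ∷ Linked-prefix (x ∷ xs) linked

Linked-suffix : ∀ xs {ys} → Linked E (xs ++ ys) → Linked E ys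
Linked-suffix [] linked = linked
Linked-suffix (_ ∷ xs) linked = Linked-suffix xs (Linked.tail linked)

Linked-join : ∀ xs {ys} → Linked E (xs ++ [ u ]) → Linked E (u ∷ ys) → Linked E (xs ++ u ∷ ys)
Linked-join [] _ linked = linked
Linked-join (_ ∷ []) (e ∷ _) linked = e ∷ linked
Linked-join (_ ∷ x ∷ xs) (e ∷ linked₁) linked₂ = e ∷ Linked-join (x ∷ xs) linked₁ linked₂

Linked-∷ʳ : ∀ xs → Linked E (xs ++ [ u ]) → E u v → Linked E ((xs ++ [ u ]) ++ [ v ])
Linked-∷ʳ [] [-] e = e ∷ [-]
Linked-∷ʳ (_ ∷ []) (e ∷ [-]) e′ = e ∷ e′ ∷ [-]
Linked-∷ʳ (_ ∷ x ∷ xs) (e ∷ linked) e′ = e ∷ Linked-∷ʳ (x ∷ xs) linked e′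

Unique-suffix : ∀ xs {ys : List (Fin n)} → Unique (xs ++ ys) → Unique ys
Unique-suffix [] unique = unique
Unique-suffix (_ ∷ xs) (_ ∷ unique) = Unique-suffix xs unique

1≤length-++-∷ : ∀ (xs : List (Fin n)) {ys} → 1 ≤ length (xs ++ u ∷ ys)
1≤length-++-∷ [] = s≤s z≤n
1≤length-++-∷ (_ ∷ _) = s≤s z≤n

∷ʳ-suffix : ∀ pre xs {post : List (Fin n)} → pre ++ u ∷ post ≡ xs ++ [ v ] → u ≢ v →
            Σ (List (Fin n)) λ ys → post ≡ ys ++ [ v ]
∷ʳ-suffix [] [] refl u≢v = ⊥-elim (u≢v refl)
∷ʳ-suffix [] (_ ∷ xs) refl _ = xs , refl
∷ʳ-suffix (_ ∷ []) [] () _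
∷ʳ-suffix (_ ∷ _ ∷ _) [] () _
∷ʳ-suffix (_ ∷ pre) (_ ∷ xs) eq u≢v = ∷ʳ-suffix pre xs (∷-injectiveʳ eq) u≢v

IsPath : EdgeRel n → Fin n → List (Fin n) → Fin n → Set
IsPath E u zs v = Linked E (u ∷ zs ++ [ v ]) × Unique (u ∷ zs ++ [ v ])

IsPath-map : E ⇒ E′ → IsPath E u zs v → IsPath E′ u zs v
IsPath-map E⇒E′ (linked , unique) = Linked.map E⇒E′ linked , unique

-- If u already lies on the path obtained from the rest of the walk, that path is cut to start at u.
Star⇒IsPath : u ≢ v → Star E u v → Σ (List (Fin n)) λ zs → IsPath E u zs v
Star⇒IsPath u≢v ε = ⊥-elim (u≢v refl)
Star⇒IsPath {u = u} {v = v} {E = E} u≢v (_◅_ {j = w} e walk) with w ≟ v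
... | yes refl = [] , e ∷ [-] , (u≢v ∷ []) ∷ [] ∷ []
... | no w≢v with Star⇒IsPath w≢v walk
...   | zs , linked , unique with DecMembership._∈?_ _≟_ u (w ∷ zs ++ [ v ])
...     | no u∉path = w ∷ zs , e ∷ linked , ¬Any⇒All¬ _ u∉path ∷ unique
...     | yes u∈path with ∈-∃++ u∈path
...       | pre , post , eq with ∷ʳ-suffix pre (w ∷ zs) (≡-sym eq) u≢v
...         | zs′ , refl = zs′ , Linked-suffix pre (subst (Linked E) eq linked) ,
                                 Unique-suffix pre (subst Unique eq unique)

crossing : (P : Fin n → Set) → Decidable P → ∀ zs → ¬ P u → P v →
           Σ (Fin n) λ c → Σ (Fin n) λ d → Consecutive c d (u ∷ zs ++ [ v ]) × ¬ P c × P d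
crossing {u = u} {v = v} P P? [] ¬Pu Pv = u , v , ([] , [] , refl) , ¬Pu , Pv
crossing {u = u} {v = v} P P? (z ∷ zs) ¬Pu Pv with P? z
... | yes Pz = u , z , ([] , zs ++ [ v ] , refl) , ¬Pu , Pz
... | no ¬Pz with crossing P P? zs ¬Pz Pv
...   | c , d , on , ¬Pc , Pd = c , d , Consecutive-∷ on , ¬Pc , Pd

find-consecutive : (Q : Fin n → Fin n → Set) → (∀ c d → Dec (Q c d)) → ∀ zs →
                   (Σ (Fin n) λ c → Σ (Fin n) λ d → Consecutive c d zs × Q c d) ⊎ Linked (λ c d → ¬ Q c d) zs
find-consecutive Q Q? [] = inj₂ []
find-consecutive Q Q? (_ ∷ []) = inj₂ [-]
find-consecutive Q Q? (c ∷ d ∷ zs) with Q? c d | find-consecutive Q Q? (d ∷ zs)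
... | yes q | _ = inj₁ (c , d , ([] , zs , refl) , q)
... | no _  | inj₁ (c′ , d′ , on , q) = inj₁ (c′ , d′ , Consecutive-∷ on , q)
... | no ¬q | inj₂ linked = inj₂ (¬q ∷ linked)

Unique-↭ : {l m : List (Fin n)} → l ↭ m → Unique l → Unique m
Unique-↭ l↭m = Unique-resp-↭ (setoid _) (↭⇒↭ₛ l↭m)

path-cycle : IsPath E h (z ∷ zs) k → E k h → Consecutive c d ((h ∷ z ∷ zs ++ [ k ]) ++ [ h ]) →
             EdgeOnCycle E c d
path-cycle {h = h} {z = z} {zs = zs} {k = k} (linked , unique) kh on =
  h , z ∷ zs ++ [ k ] , s≤s (1≤length-++-∷ zs) , unique , Linked-∷ʳ (h ∷ z ∷ zs) linked kh , on

rotate-at-closing : ∀ xs → u ∷ zs ≡ xs ++ [ a ] → 2 ≤ length zs → Unique (u ∷ zs) →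
                    Linked E (u ∷ zs ++ [ u ]) → Σ (List (Fin n)) λ ws → 1 ≤ length ws × IsPath E u ws a
rotate-at-closing [] refl () _ _
rotate-at-closing (_ ∷ []) refl (s≤s ()) _ _
rotate-at-closing {u = u} {a = a} (_ ∷ z ∷ xs) refl _ unique linked =
  z ∷ xs , s≤s z≤n , Linked-prefix (u ∷ z ∷ xs ++ [ a ]) linked , unique

rotate-at-inner : ∀ xs ys → u ∷ zs ≡ xs ++ a ∷ b ∷ ys → 2 ≤ length zs → Unique (u ∷ zs) →
                  Linked E (xs ++ a ∷ b ∷ ys ++ [ u ]) →
                  Σ (List (Fin n)) λ ws → 1 ≤ length ws × IsPath E b ws a
rotate-at-inner [] ys refl (s≤s 1≤|ys|) unique linked =
  ys , 1≤|ys| , Linked.tail linked , Unique-↭ (++-comm [ _ ] (_ ∷ ys)) unique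
rotate-at-inner {u = u} {a = a} {b = b} {E = E} (_ ∷ xs) ys refl _ unique linked =
  ys ++ u ∷ xs , 1≤length-++-∷ ys , rotated ,
  Unique-↭ (↭-trans (++-comm (u ∷ xs) (a ∷ b ∷ ys)) (++-comm [ a ] (b ∷ ys ++ u ∷ xs))) unique
  where
  split : Linked E ((u ∷ xs ++ [ a ]) ++ b ∷ ys ++ [ u ])
  split = subst (Linked E) (cong (u ∷_) (≡-sym (++-assoc xs [ a ] (b ∷ ys ++ [ u ])))) linked
  rotated : Linked E (b ∷ (ys ++ u ∷ xs) ++ [ a ])
  rotated = subst (λ l → Linked E (b ∷ l)) (≡-sym (++-assoc ys (u ∷ xs) [ a ]))
              (Linked-join (b ∷ ys) (Linked-suffix (u ∷ xs ++ [ a ]) split)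
                                    (Linked-prefix (u ∷ xs ++ [ a ]) split))

-- Rotating the cycle so that it closes with the edge ab leaves a path from b to a.
cycle⇒path : EdgeOnCycle E a b → Σ (List (Fin n)) λ zs → 1 ≤ length zs × IsPath E b zs a
cycle⇒path {a = a} {b = b} (u , ws , 2≤|ws| , unique , linked , xs , ys , eq) with initLast ys
... | [] with ∷ʳ-injective (u ∷ ws) (xs ++ [ a ]) (trans eq (≡-sym (++-assoc xs [ a ] [ b ])))
...   | ws≡ , refl = rotate-at-closing xs ws≡ 2≤|ws| unique linked
cycle⇒path {E = E} {a = a} {b = b} (u , ws , 2≤|ws| , unique , linked , xs , ys , eq) | ys′ ∷ʳ′ y
  with ∷ʳ-injective (u ∷ ws) (xs ++ a ∷ b ∷ ys′) (trans eq (≡-sym (++-assoc xs (a ∷ b ∷ ys′) [ y ])))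
... | ws≡ , refl = rotate-at-inner xs ys′ ws≡ 2≤|ws| unique (subst (Linked E) eq linked)

≉-from-avoiding : w ≢ a × w ≢ b → ¬ SameEdge w t a b
≉-from-avoiding (w≢a , _) (inj₁ (w≡a , _)) = w≢a w≡a
≉-from-avoiding (_ , w≢b) (inj₂ (w≡b , _)) = w≢b w≡b

inner-avoids : ∀ zs → All (b ≢_) (zs ++ [ a ]) → Unique (zs ++ [ a ]) → All (λ z → z ≢ a × z ≢ b) zs
inner-avoids [] _ _ = []
inner-avoids (z ∷ zs) (b≢z ∷ b≢zs) (z≢zs ∷ unique) =
  (All.head (++⁻ʳ zs z≢zs) , b≢z ∘ ≡-sym) ∷ inner-avoids zs b≢zs unique

avoiding-walk : ∀ zs → Linked E (w ∷ zs ++ [ a ]) → w ≢ a × w ≢ b → All (λ z → z ≢ a × z ≢ b) zs →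
                Star (delE a b E) w a
avoiding-walk [] (e ∷ [-]) w-avoids [] = (e , ≉-from-avoiding w-avoids) ◅ ε
avoiding-walk (z ∷ zs) (e ∷ linked) w-avoids (z-avoids ∷ avoids) =
  (e , ≉-from-avoiding w-avoids) ◅ avoiding-walk zs linked z-avoids avoids

cycle-bypass : EdgeOnCycle E a b → Star (delE a b E) b a
cycle-bypass cycle with cycle⇒path cycle
... | z ∷ zs , _ , e ∷ linked , b≢ ∷ unique with inner-avoids (z ∷ zs) b≢ unique
...   | z-avoids ∷ avoids =
  (e , ≉-from-avoiding z-avoids ∘ SameEdge-swap) ◅ avoiding-walk zs linked z-avoids avoids

-- Spanning trees and edge exchange

Acyclic-⊆ : E ⇒ E′ → Acyclic E′ → Acyclic E
Acyclic-⊆ E⇒E′ acyclic p q (u , ws , len , unique , linked , on) =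
  acyclic p q (u , ws , len , unique , Linked.map E⇒E′ linked , on)

insE-acyclic : Symmetric F → Acyclic F → ¬ Star F h k → Acyclic (insE h k F)
insE-acyclic {F = F} {h = h} {k = k} F-sym F-acyclic h↛k p q (u , ws , len , unique , linked , on)
  with find-consecutive (λ s t → SameEdge s t h k) (λ s t → SameEdge? s t h k) (u ∷ ws ++ [ u ])
... | inj₂ avoids = F-acyclic p q (u , ws , len , unique , Linked.zipWith old-edge (linked , avoids) , on)
  where
  old-edge : insE h k F s t × ¬ SameEdge s t h k → F s t
  old-edge (inj₁ Fst , _) = Fst
  old-edge (inj₂ st≈hk , st≉hk) = ⊥-elim (st≉hk st≈hk)
... | inj₁ (a , b , ab-on , ab≈hk) =
  h↛k (SameEdge-resp (Star.reverse F-sym)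
                     (Star.map old-edge (cycle-bypass (u , ws , len , unique , linked , ab-on)))
                     (SameEdge-flip (SameEdge-sym ab≈hk)))
  where
  old-edge : delE a b (insE h k F) ⇒ F
  old-edge (inj₁ Fst , _) = Fst
  old-edge (inj₂ st≈hk , st≉ab) = ⊥-elim (st≉ab (SameEdge-trans st≈hk (SameEdge-sym ab≈hk)))

bridge : Symmetric F → Acyclic F → F x y → x ≢ y → ¬ Star (delE x y F) x y
bridge {x = x} {y = y} F-sym F-acyclic Fxy x≢y walk with Star⇒IsPath x≢y walk
... | [] , e ∷ [-] , _ = proj₂ e (inj₁ (refl , refl))
... | z ∷ zs , path = F-acyclic y x (path-cycle (IsPath-map {zs = z ∷ zs} proj₁ path) (F-sym Fxy)
                                      (x ∷ z ∷ zs , [] , cong (λ l → x ∷ z ∷ l) (++-assoc zs [ y ] [ x ])))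

SplitAt-disjoint : Symmetric F → Acyclic F → x ≢ y → SplitAt F x y C D → v ∈ C → v ∈ D → ⊥
SplitAt-disjoint F-sym F-acyclic x≢y (Fxy , C-comp , D-comp) v∈C v∈D =
  bridge F-sym F-acyclic Fxy x≢y
    (Component-reach C-comp v∈C ◅◅ Star.reverse (delE-sym F-sym) (Component-reach D-comp v∈D))

-- BUD G a b F F′ unfolds to ExchangeStep G F F′ × B2 G a b F′.
ExchangeStep : Graph n → EdgeRel n → EdgeRel n → Set
ExchangeStep G F F′ =
  Σ _ λ u → Σ _ λ v → Adj G u v × ¬ F u v ×
    (Σ _ λ p → Σ _ λ q → EdgeOnCycle (insE u v F) p q ×
      (∀ s t → (F′ s t → delE p q (insE u v F) s t) × (delE p q (insE u v F) s t → F′ s t)))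

-- The cycle closed by uv leaves S through an edge c′d′ of the tree path from u to v;
-- the hypothesis forces c′d′ to be cd, and cd can be dropped because uv reconnects its ends.
exchange : (G : Graph n) → IsSpanningTree G F → Adj G u v → ¬ F u v →
           (S : Subset n) → u ∉ S → v ∈ S → CrossesOnlyAt F S c d →
           ExchangeStep G F (insE u v (delE c d F)) × IsSpanningTree G (insE u v (delE c d F))
exchange {n = n} {F = F} {u = u} {v = v} {c = c} {d = d} G
         (F⊆G , F-sym , F-connected , F-acyclic) uv ¬Fuv S u∉S v∈S only-cd
  with Star⇒IsPath (λ { refl → u∉S v∈S }) (F-connected u v)
... | [] , Fuv ∷ [-] , _ = ⊥-elim (¬Fuv Fuv)
... | z ∷ zs , path with crossing (_∈ S) (_∈ˢ? S) (z ∷ zs) u∉S v∈S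
...   | c′ , d′ , c′d′-on@(xs , _ , eq) , c′∉S , d′∈S =
  (u , v , uv , ¬Fuv , c′ , d′ , cycle , λ _ _ → to , from) , N⊆G , N-sym , N-connected , N-acyclic
  where
  N : EdgeRel n
  N = insE u v (delE c d F)

  Fc′d′ : F c′ d′
  Fc′d′ = Linked-at xs (subst (Linked F) eq (proj₁ path))

  c′d′≈cd : SameEdge c′ d′ c d
  c′d′≈cd = only-cd Fc′d′ c′∉S d′∈S

  cycle : EdgeOnCycle (insE u v F) c′ d′
  cycle = path-cycle (IsPath-map {zs = z ∷ zs} inj₁ path) (inj₂ (inj₂ (refl , refl)))
                     (Consecutive-++ [ u ] c′d′-on)

  to : N ⇒ delE c′ d′ (insE u v F)
  to (inj₁ (Fst , st≉cd)) = inj₁ Fst , λ st≈c′d′ → st≉cd (SameEdge-trans st≈c′d′ c′d′≈cd)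
  to (inj₂ st≈uv) = inj₂ st≈uv , λ st≈c′d′ →
    ¬Fuv (SameEdge-resp F-sym Fc′d′ (SameEdge-trans (SameEdge-sym st≈uv) st≈c′d′))

  from : delE c′ d′ (insE u v F) ⇒ N
  from (inj₁ Fst , st≉c′d′) = inj₁ (Fst , λ st≈cd → st≉c′d′ (SameEdge-trans st≈cd (SameEdge-sym c′d′≈cd)))
  from (inj₂ st≈uv , _) = inj₂ st≈uv

  N⊆G : N ⇒ Adj G
  N⊆G (inj₁ (Fst , _)) = F⊆G Fst
  N⊆G (inj₂ st≈uv) = SameEdge-resp (Graph.sym G) uv st≈uv

  N-sym : Symmetric N
  N-sym = insE-sym (delE-sym F-sym)

  F⇒N⋆ : F ⇒ Star N
  F⇒N⋆ {s} {t} Fst with SameEdge? s t c d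
  ... | no st≉cd = inj₁ (Fst , st≉cd) ◅ ε
  ... | yes st≈cd = SameEdge-resp (Star.reverse N-sym) (Star.map from (cycle-bypass cycle))
                                  (SameEdge-trans st≈cd (SameEdge-flip (SameEdge-sym c′d′≈cd)))

  N-connected : ∀ s t → Star N s t
  N-connected s t = (F⇒N⋆ ⋆) (F-connected s t)

  outside-S : (_∉ S) Respects delE c d F
  outside-S (Fst , st≉cd) s∉S t∈S = st≉cd (only-cd Fst s∉S t∈S)

  N-acyclic : Acyclic N
  N-acyclic = insE-acyclic (delE-sym F-sym) (Acyclic-⊆ proj₁ F-acyclic)
                (λ walk → Star-preserves outside-S walk u∉S v∈S)

-- The two exchanges

module TwoExchanges
  {n} (G : Graph n) {T : EdgeRel n} (T-tree : IsSpanningTree G T)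
  {x y : Fin n} {T₁ T₂ : Subset n} (T-split : SplitAt T x y T₁ T₂)
  {p₁ q₁ : Fin n} {K₁ H₁ : Subset n} (p₁∈T₁ : p₁ ∈ T₁) (q₁∈T₁ : q₁ ∈ T₁)
  (split₁ : SplitAt (delE x y T) p₁ q₁ K₁ H₁)
  {p₂ q₂ : Fin n} {K₂ H₂ : Subset n} (p₂∈T₂ : p₂ ∈ T₂) (q₂∈T₂ : q₂ ∈ T₂)
  (split₂ : SplitAt (delE x y T) p₂ q₂ K₂ H₂)
  {h₁ k₂ : Fin n} (h₁∈H₁ : h₁ ∈ H₁) (k₂∈K₂ : k₂ ∈ K₂) (h₁k₂ : Adj G h₁ k₂)
  {h₂ k₁ : Fin n} (h₂∈H₂ : h₂ ∈ H₂) (k₁∈K₁ : k₁ ∈ K₁) (h₂k₁ : Adj G h₂ k₁)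
  {a b : ℕ} (∣T₁∣≡a : ∣ T₁ ∣ ≡ a) (∣T₂∣≡b : ∣ T₂ ∣ ≡ b) (∣H₁∣≡∣H₂∣ : ∣ H₁ ∣ ≡ ∣ H₂ ∣)
  where

  open ≡-Reasoning

  Forest₂ Forest₄ T′ : EdgeRel n
  Forest₂ = delE x y T
  Forest₄ = delE p₂ q₂ (delE p₁ q₁ Forest₂)
  T′ = insE h₁ k₂ Forest₂

  T̃ : EdgeRel n → EdgeRel n
  T̃ P = insE h₂ k₁ (delE p₁ q₁ P)

  T-sym : Symmetric T
  T-sym = proj₁ (proj₂ T-tree)

  T-acyclic : Acyclic T
  T-acyclic = proj₂ (proj₂ (proj₂ T-tree))

  T-loopless : T s t → s ≢ t
  T-loopless Tst refl = irrefl G (proj₁ T-tree Tst)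

  Forest₂-sym : Symmetric Forest₂
  Forest₂-sym = delE-sym T-sym

  Forest₂-acyclic : Acyclic Forest₂
  Forest₂-acyclic = Acyclic-⊆ proj₁ T-acyclic

  T₁-comp : Component Forest₂ x T₁
  T₁-comp = proj₁ (proj₂ T-split)

  T₂-comp : Component Forest₂ y T₂
  T₂-comp = proj₂ (proj₂ T-split)

  T₁∩T₂ : v ∈ T₁ → v ∈ T₂ → ⊥
  T₁∩T₂ = SplitAt-disjoint T-sym T-acyclic (T-loopless (proj₁ T-split)) T-split

  K₁∩H₁ : v ∈ K₁ → v ∈ H₁ → ⊥
  K₁∩H₁ = SplitAt-disjoint Forest₂-sym Forest₂-acyclic (T-loopless (proj₁ (proj₁ split₁))) split₁

  K₂∩H₂ : v ∈ K₂ → v ∈ H₂ → ⊥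
  K₂∩H₂ = SplitAt-disjoint Forest₂-sym Forest₂-acyclic (T-loopless (proj₁ (proj₁ split₂))) split₂

  K₁⊆T₁ : K₁ ⊆ T₁
  K₁⊆T₁ = Component-mono proj₁ (proj₁ (proj₂ split₁)) T₁-comp p₁∈T₁

  H₁⊆T₁ : H₁ ⊆ T₁
  H₁⊆T₁ = Component-mono proj₁ (proj₂ (proj₂ split₁)) T₁-comp q₁∈T₁

  K₂⊆T₂ : K₂ ⊆ T₂
  K₂⊆T₂ = Component-mono proj₁ (proj₁ (proj₂ split₂)) T₂-comp p₂∈T₂

  H₂⊆T₂ : H₂ ⊆ T₂
  H₂⊆T₂ = Component-mono proj₁ (proj₂ (proj₂ split₂)) T₂-comp q₂∈T₂

  T₂⇒∉T₁ : v ∈ T₂ → v ∉ T₁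
  T₂⇒∉T₁ v∈T₂ v∈T₁ = T₁∩T₂ v∈T₁ v∈T₂

  ∣K₁∪H₂∣≡a : ∣ K₁ ∪ H₂ ∣ ≡ a
  ∣K₁∪H₂∣≡a = begin
    ∣ K₁ ∪ H₂ ∣     ≡⟨ ∣p∪q∣≡∣p∣+∣q∣ K₁ H₂ (λ v∈K₁ v∈H₂ → T₁∩T₂ (K₁⊆T₁ v∈K₁) (H₂⊆T₂ v∈H₂)) ⟩
    ∣ K₁ ∣ + ∣ H₂ ∣ ≡⟨ cong (∣ K₁ ∣ +_) (≡-sym ∣H₁∣≡∣H₂∣) ⟩
    ∣ K₁ ∣ + ∣ H₁ ∣ ≡⟨ ≡-sym (∣p∪q∣≡∣p∣+∣q∣ K₁ H₁ K₁∩H₁) ⟩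
    ∣ K₁ ∪ H₁ ∣     ≡⟨ cong ∣_∣ (≡-sym (Component-split Forest₂-sym T₁-comp p₁∈T₁ split₁)) ⟩
    ∣ T₁ ∣          ≡⟨ ∣T₁∣≡a ⟩
    a               ∎

  ∣K₂∪H₁∣≡b : ∣ K₂ ∪ H₁ ∣ ≡ b
  ∣K₂∪H₁∣≡b = begin
    ∣ K₂ ∪ H₁ ∣     ≡⟨ ∣p∪q∣≡∣p∣+∣q∣ K₂ H₁ (λ v∈K₂ v∈H₁ → T₁∩T₂ (H₁⊆T₁ v∈H₁) (K₂⊆T₂ v∈K₂)) ⟩
    ∣ K₂ ∣ + ∣ H₁ ∣ ≡⟨ cong (∣ K₂ ∣ +_) ∣H₁∣≡∣H₂∣ ⟩
    ∣ K₂ ∣ + ∣ H₂ ∣ ≡⟨ ≡-sym (∣p∪q∣≡∣p∣+∣q∣ K₂ H₂ K₂∩H₂) ⟩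
    ∣ K₂ ∪ H₂ ∣     ≡⟨ cong ∣_∣ (≡-sym (Component-split Forest₂-sym T₂-comp p₂∈T₂ split₂)) ⟩
    ∣ T₂ ∣          ≡⟨ ∣T₂∣≡b ⟩
    b               ∎

  h₁∈T₁ : h₁ ∈ T₁
  h₁∈T₁ = H₁⊆T₁ h₁∈H₁

  k₁∈T₁ : k₁ ∈ T₁
  k₁∈T₁ = K₁⊆T₁ k₁∈K₁

  h₂∈T₂ : h₂ ∈ T₂
  h₂∈T₂ = H₂⊆T₂ h₂∈H₂

  k₂∈T₂ : k₂ ∈ T₂
  k₂∈T₂ = K₂⊆T₂ k₂∈K₂

  T′-split : SplitAt T′ h₁ k₂ T₁ T₂
  T′-split =
    inj₂ (inj₁ (refl , refl)) ,
    Component-delE-insE (Component-reroot Forest₂-sym T₁-comp h₁∈T₁) (λ (_ , k₂∈T₁) → T₁∩T₂ k₂∈T₁ k₂∈T₂) ,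
    Component-delE-insE (Component-reroot Forest₂-sym T₂-comp k₂∈T₂) (λ (h₁∈T₂ , _) → T₁∩T₂ h₁∈T₁ h₁∈T₂)

  first-exchange : ¬ SameEdge h₁ k₂ x y → ExchangeStep G T T′ × IsSpanningTree G T′
  first-exchange h₁k₂≉xy =
    exchange G T-tree h₁k₂ ¬Th₁k₂ T₂ (T₁∩T₂ h₁∈T₁) k₂∈T₂ (Component-crossing T-sym T₂-comp)
    where
    ¬Th₁k₂ : ¬ T h₁ k₂
    ¬Th₁k₂ Th₁k₂ = T₁∩T₂ (Component-closed T₁-comp (Th₁k₂ , h₁k₂≉xy) h₁∈T₁) k₂∈T₂

  first-bud : ¬ SameEdge h₁ k₂ x y → BUD G a b T T′
  first-bud h₁k₂≉xy =
    proj₁ (first-exchange h₁k₂≉xy) , proj₂ (first-exchange h₁k₂≉xy) ,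
    h₁ , k₂ , T₁ , T₂ , T′-split , ∣T₁∣≡a , ∣T₂∣≡b

  T⇔T′ : SameEdge h₁ k₂ x y → T ⇔ T′
  T⇔T′ = reinsert T-sym (proj₁ T-split)

  K₁∪H₂∩K₂∪H₁ : v ∈ K₁ ∪ H₂ → v ∈ K₂ ∪ H₁ → ⊥
  K₁∪H₂∩K₂∪H₁ v∈K₁∪H₂ v∈K₂∪H₁ with x∈p∪q⁻ K₁ H₂ v∈K₁∪H₂ | x∈p∪q⁻ K₂ H₁ v∈K₂∪H₁
  ... | inj₁ v∈K₁ | inj₁ v∈K₂ = T₁∩T₂ (K₁⊆T₁ v∈K₁) (K₂⊆T₂ v∈K₂)
  ... | inj₁ v∈K₁ | inj₂ v∈H₁ = K₁∩H₁ v∈K₁ v∈H₁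
  ... | inj₂ v∈H₂ | inj₁ v∈K₂ = K₂∩H₂ v∈K₂ v∈H₂
  ... | inj₂ v∈H₂ | inj₂ v∈H₁ = T₁∩T₂ (H₁⊆T₁ v∈H₁) (H₂⊆T₂ v∈H₂)

  h₁k₂-outside-K₁∪H₂ : SameEdge s t h₁ k₂ → s ∉ K₁ ∪ H₂ × t ∉ K₁ ∪ H₂
  h₁k₂-outside-K₁∪H₂ = SameEdge-ends (_∉ K₁ ∪ H₂)
    (λ h₁∈ → K₁∪H₂∩K₂∪H₁ h₁∈ (x∈p∪q⁺ (inj₂ h₁∈H₁))) (λ k₂∈ → K₁∪H₂∩K₂∪H₁ k₂∈ (x∈p∪q⁺ (inj₁ k₂∈K₂)))

  h₂k₁-outside-K₂∪H₁ : SameEdge s t h₂ k₁ → s ∉ K₂ ∪ H₁ × t ∉ K₂ ∪ H₁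
  h₂k₁-outside-K₂∪H₁ = SameEdge-ends (_∉ K₂ ∪ H₁)
    (λ h₂∈ → K₁∪H₂∩K₂∪H₁ (x∈p∪q⁺ (inj₂ h₂∈H₂)) h₂∈) (λ k₁∈ → K₁∪H₂∩K₂∪H₁ (x∈p∪q⁺ (inj₁ k₁∈K₁)) k₁∈)

  ≉p₁q₁ : s ∉ T₁ ⊎ t ∉ T₁ → ¬ SameEdge s t p₁ q₁
  ≉p₁q₁ = SameEdge-leaves (_∈ T₁) p₁∈T₁ q₁∈T₁

  ≉p₂q₂ : s ∉ T₂ ⊎ t ∉ T₂ → ¬ SameEdge s t p₂ q₂
  ≉p₂q₂ = SameEdge-leaves (_∈ T₂) p₂∈T₂ q₂∈T₂

  Forest₄-sym : Symmetric Forest₄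
  Forest₄-sym = delE-sym (delE-sym Forest₂-sym)

  Forest₄-within-T₁ : C ⊆ T₁ → Component (delE p₁ q₁ Forest₂) z C → Component Forest₄ z C
  Forest₄-within-T₁ C⊆T₁ comp =
    Component-resp comp (λ s∈C e → e , ≉p₂q₂ (inj₁ (T₁∩T₂ (C⊆T₁ s∈C)))) (λ _ → proj₁)

  Forest₄-within-T₂ : C ⊆ T₂ → Component (delE p₂ q₂ Forest₂) z C → Component Forest₄ z C
  Forest₄-within-T₂ C⊆T₂ comp =
    Component-resp comp (λ s∈C (e , st≉p₂q₂) → (e , ≉p₁q₁ (inj₁ (T₂⇒∉T₁ (C⊆T₂ s∈C)))) , st≉p₂q₂)
                        (λ _ ((e , _) , st≉p₂q₂) → e , st≉p₂q₂)

  module _ {P : EdgeRel n} (P⇔T′ : P ⇔ T′) where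

    P⇒T′ : P ⇒ T′
    P⇒T′ = proj₁ P⇔T′

    T′⇒P : T′ ⇒ P
    T′⇒P = proj₂ P⇔T′

    ¬Ph₂k₁ : ¬ P h₂ k₁
    ¬Ph₂k₁ Ph₂k₁ with P⇒T′ Ph₂k₁
    ... | inj₁ F₂h₂k₁ = T₁∩T₂ k₁∈T₁ (Component-closed T₂-comp F₂h₂k₁ h₂∈T₂)
    ... | inj₂ h₂k₁≈h₁k₂ = proj₁ (h₁k₂-outside-K₁∪H₂ h₂k₁≈h₁k₂) (x∈p∪q⁺ (inj₂ h₂∈H₂))

    P-crosses-K₁ : CrossesOnlyAt P K₁ p₁ q₁
    P-crosses-K₁ Pst s∉K₁ t∈K₁ with P⇒T′ Pst
    ... | inj₁ F₂st = Component-crossing Forest₂-sym (proj₁ (proj₂ split₁)) F₂st s∉K₁ t∈K₁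
    ... | inj₂ st≈h₁k₂ = ⊥-elim (proj₂ (h₁k₂-outside-K₁∪H₂ st≈h₁k₂) (x∈p∪q⁺ (inj₁ t∈K₁)))

    second-exchange : IsSpanningTree G P → ExchangeStep G P (T̃ P) × IsSpanningTree G (T̃ P)
    second-exchange P-tree =
      exchange G P-tree h₂k₁ ¬Ph₂k₁ K₁ (λ h₂∈K₁ → T₁∩T₂ (K₁⊆T₁ h₂∈K₁) h₂∈T₂) k₁∈K₁ P-crosses-K₁

    R : EdgeRel n
    R = delE q₂ p₂ (T̃ P)

    R-sym : Symmetric R
    R-sym = delE-sym (insE-sym (delE-sym (λ Pst → T′⇒P (insE-sym Forest₂-sym (P⇒T′ Pst)))))

    Forest₄⇒R : Forest₄ ⇒ R
    Forest₄⇒R ((F₂st , st≉p₁q₁) , st≉p₂q₂) = inj₁ (T′⇒P (inj₁ F₂st) , st≉p₁q₁) , st≉p₂q₂ ∘ SameEdge-flip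

    R-old-edge : P s t → ¬ SameEdge s t p₁ q₁ → ¬ SameEdge s t q₂ p₂ → Forest₄ s t ⊎ SameEdge s t h₁ k₂
    R-old-edge Pst st≉p₁q₁ st≉q₂p₂ with P⇒T′ Pst
    ... | inj₁ F₂st = inj₁ ((F₂st , st≉p₁q₁) , st≉q₂p₂ ∘ SameEdge-flip)
    ... | inj₂ st≈h₁k₂ = inj₂ st≈h₁k₂

    R-within-K₁∪H₂ : s ∈ K₁ ∪ H₂ → R s t → Forest₄ s t ⊎ SameEdge s t k₁ h₂
    R-within-K₁∪H₂ _ (inj₂ st≈h₂k₁ , _) = inj₂ (SameEdge-flip st≈h₂k₁)
    R-within-K₁∪H₂ s∈K₁∪H₂ (inj₁ (Pst , st≉p₁q₁) , st≉q₂p₂) with R-old-edge Pst st≉p₁q₁ st≉q₂p₂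
    ... | inj₁ F₄st = inj₁ F₄st
    ... | inj₂ st≈h₁k₂ = ⊥-elim (proj₁ (h₁k₂-outside-K₁∪H₂ st≈h₁k₂) s∈K₁∪H₂)

    R-within-K₂∪H₁ : s ∈ K₂ ∪ H₁ → R s t → Forest₄ s t ⊎ SameEdge s t k₂ h₁
    R-within-K₂∪H₁ s∈K₂∪H₁ (inj₂ st≈h₂k₁ , _) = ⊥-elim (proj₁ (h₂k₁-outside-K₂∪H₁ st≈h₂k₁) s∈K₂∪H₁)
    R-within-K₂∪H₁ _ (inj₁ (Pst , st≉p₁q₁) , st≉q₂p₂) with R-old-edge Pst st≉p₁q₁ st≉q₂p₂
    ... | inj₁ F₄st = inj₁ F₄st
    ... | inj₂ st≈h₁k₂ = inj₂ (SameEdge-flip st≈h₁k₂)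

    T̃-split : SplitAt (T̃ P) q₂ p₂ (K₁ ∪ H₂) (K₂ ∪ H₁)
    T̃-split = T̃q₂p₂ , Component-reroot R-sym K₁∪H₂-comp (x∈p∪q⁺ (inj₂ q₂∈H₂)) , K₂∪H₁-comp
      where
      q₂∈H₂ : q₂ ∈ H₂
      q₂∈H₂ = Component-root (proj₂ (proj₂ split₂))

      T̃q₂p₂ : T̃ P q₂ p₂
      T̃q₂p₂ = inj₁ (T′⇒P (inj₁ (Forest₂-sym (proj₁ split₂))) , ≉p₁q₁ (inj₁ (T₂⇒∉T₁ q₂∈T₂)))

      Rk₁h₂ : R k₁ h₂
      Rk₁h₂ = inj₂ (inj₂ (refl , refl)) , ≉p₂q₂ (inj₁ (T₁∩T₂ k₁∈T₁)) ∘ SameEdge-flip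

      Rk₂h₁ : R k₂ h₁
      Rk₂h₁ = inj₁ (T′⇒P (inj₂ (inj₂ (refl , refl))) , ≉p₁q₁ (inj₁ (T₂⇒∉T₁ k₂∈T₂))) ,
              ≉p₂q₂ (inj₂ (T₁∩T₂ h₁∈T₁)) ∘ SameEdge-flip

      K₁∪H₂-comp : Component R p₁ (K₁ ∪ H₂)
      K₁∪H₂-comp = Component-join Forest₄-sym
        (Forest₄-within-T₁ K₁⊆T₁ (proj₁ (proj₂ split₁))) (Forest₄-within-T₂ H₂⊆T₂ (proj₂ (proj₂ split₂)))
        Forest₄⇒R Rk₁h₂ k₁∈K₁ h₂∈H₂ R-within-K₁∪H₂

      K₂∪H₁-comp : Component R p₂ (K₂ ∪ H₁)
      K₂∪H₁-comp = Component-join Forest₄-sym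
        (Forest₄-within-T₂ K₂⊆T₂ (proj₁ (proj₂ split₂))) (Forest₄-within-T₁ H₁⊆T₁ (proj₂ (proj₂ split₁)))
        Forest₄⇒R Rk₂h₁ k₂∈K₂ h₁∈H₁ R-within-K₂∪H₁

    second-bud : IsSpanningTree G P → BUD G a b P (T̃ P)
    second-bud P-tree =
      proj₁ (second-exchange P-tree) , proj₂ (second-exchange P-tree) ,
      q₂ , p₂ , K₁ ∪ H₂ , K₂ ∪ H₁ , T̃-split , ∣K₁∪H₂∣≡a , ∣K₂∪H₁∣≡b

lemma4p4 : ∀ {n} (G : Graph n) (a b : ℕ) → a + b ≡ n → Connected G →
    (T : EdgeRel n) → B2 G a b T →
    (x y : Fin n) (T₁ T₂ : Subset n) → SplitAt T x y T₁ T₂ → ∣ T₁ ∣ ≡ a → ∣ T₂ ∣ ≡ b →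
    (p₁ q₁ : Fin n) (K₁ H₁ : Subset n) → p₁ ∈ T₁ → q₁ ∈ T₁ →
    SplitAt (delE x y T) p₁ q₁ K₁ H₁ →
    (p₂ q₂ : Fin n) (K₂ H₂ : Subset n) → p₂ ∈ T₂ → q₂ ∈ T₂ →
    SplitAt (delE x y T) p₂ q₂ K₂ H₂ →
    ∣ H₁ ∣ ≡ ∣ H₂ ∣ →
    (Σ (Fin n) λ h → Σ (Fin n) λ k → h ∈ H₁ × k ∈ K₂ × Adj G h k) →
    (Σ (Fin n) λ h → Σ (Fin n) λ k → h ∈ H₂ × k ∈ K₁ × Adj G h k) →
    Σ (EdgeRel n) λ T̃ →
      (BUD G a b T T̃ ⊎ Σ (EdgeRel n) λ T′ → BUD G a b T T′ × BUD G a b T′ T̃) ×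
      (Σ (Fin n) λ x̃ → Σ (Fin n) λ ỹ → Σ (Subset n) λ T̃₁ → Σ (Subset n) λ T̃₂ →
        SplitAt T̃ x̃ ỹ T̃₁ T̃₂ × T̃₁ ≡ K₁ ∪ H₂ × T̃₂ ≡ K₂ ∪ H₁)
lemma4p4 G a b _ _ T (T-tree , _) x y T₁ T₂ T-split ∣T₁∣≡a ∣T₂∣≡b
         p₁ q₁ K₁ H₁ p₁∈T₁ q₁∈T₁ split₁ p₂ q₂ K₂ H₂ p₂∈T₂ q₂∈T₂ split₂ ∣H₁∣≡∣H₂∣
         (h₁ , k₂ , h₁∈H₁ , k₂∈K₂ , h₁k₂) (h₂ , k₁ , h₂∈H₂ , k₁∈K₁ , h₂k₁) =
  case SameEdge? h₁ k₂ x y of λ where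
    (yes h₁k₂≈xy) →
      T̃ T , inj₁ (second-bud (T⇔T′ h₁k₂≈xy) T-tree) ,
      q₂ , p₂ , K₁ ∪ H₂ , K₂ ∪ H₁ , T̃-split (T⇔T′ h₁k₂≈xy) , refl , refl
    (no h₁k₂≉xy) →
      T̃ T′ , inj₂ (T′ , first-bud h₁k₂≉xy , second-bud (id , id) (proj₂ (first-exchange h₁k₂≉xy))) ,
      q₂ , p₂ , K₁ ∪ H₂ , K₂ ∪ H₁ , T̃-split (id , id) , refl , refl
  where
  open TwoExchanges G T-tree T-split p₁∈T₁ q₁∈T₁ split₁ p₂∈T₂ q₂∈T₂ split₂
                    h₁∈H₁ k₂∈K₂ h₁k₂ h₂∈H₂ k₁∈K₁ h₂k₁ ∣T₁∣≡a ∣T₂∣≡b ∣H₁∣≡∣H₂∣
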